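{- Let $y_n=n$ for $n\ge1$. Then its output array is the Catalan triangle, i.e. $A(n,k)=\frac{n-k+1}{n+1}\binom{n+k}{k}$ for $0\le k\le n$ and $A(n,k)=0$ for $k>n$, and for $n\ge3$: $$W(n)=C_{n+1}=\frac{1}{n+2}\binom{2n+2}{n+1},\quad T(n)=\frac{n+2}{2n+1},\quad M(n)=\frac{(n+2)(5n-7)}{4(2n+1)(2n-1)},\quad S(n)=\frac{3(n-3)(n-2)}{4(2n+1)(2n-1)}.$$ Consequently $\lim_{n\to\infty}T(n)=\frac12$, $\lim_{n\to\infty}M(n)=\frac5{16}$, $\lim_{n\to\infty}S(n)=\frac3{16}$.
   Context: For a nondecreasing sequence $(y_n)_{n\ge1}$ of positive integers and a positive integer $n$, an $n$-tuple $(x_1,\dots,x_n)$ of nonnegative integers is valid if $x_1\le y_n$ and $x_{j+1}\le\min(x_j,y_{n-j})$ for $1\le j\le n-1$. $A(n,k)$ is the number of valid $n$-tuples with $x_1=k$, and $W(n)=\sum_{k=0}^{y_n}A(n,k)$. For $n\ge3$ define $$T(n)=\frac{(1+y_n-y_{n-1})W(n-1)}{W(n)},\qquad M(n)=\frac{\sum_{k=1}^{(y_{n-1}-y_{n-2})+1}\big(W(n-1)-kW(n-2)\big)}{W(n)},\qquad S(n)=1-M(n)-T(n).$$ $C_m=\frac{1}{m+1}\binom{2m}{m}$ denotes the $m$-th Catalan number. -}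

module Defs where

open import Data.Bool using (Bool; true; false; _∧_)
open import Data.Nat as ℕ using (ℕ; zero; suc; _≤ᵇ_; _∸_)
open import Data.Integer using (+_)
open import Data.List using (List; []; _∷_; [_]; map; concatMap; upTo; filterᵇ; length)
open import Data.Vec using (Vec; []; _∷_)
open import Data.Rational using (ℚ; 0ℚ; 1ℚ; _+_; _-_; _*_; _÷_; ∣_∣; _<_; _>_; ≢-nonZero)
open import Data.Rational.Properties using (_≟_)
open import Data.Nat.Combinatorics using (_C_)
open import Data.Product using (∃)
open import Relation.Nullary using (yes; no)

⟦_⟧ : ℕ → ℚ
⟦ n ⟧ = + n Data.Rational./ 1

-- total division on ℚ (returns 0 when the divisor is 0; only used with nonzero divisors)
_÷ₜ_ : ℚ → ℚ → ℚ
p ÷ₜ q with q ≟ 0ℚ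
... | yes _ = 0ℚ
... | no q≢0 = _÷_ p q {{≢-nonZero q≢0}}

-- Valid tuples for a sequence y.
-- chain y m p zs : the remaining entries zs = (x_{j+1},...,x_n), m = n - j,
-- p = x_j, checks x_{i+1} ≤ min(x_i , y_{n-i}) for i = j..n-1.
chain : (ℕ → ℕ) → (m : ℕ) → ℕ → Vec ℕ m → Bool
chain y zero    p []       = true
chain y (suc m) p (z ∷ zs) = (z ≤ᵇ p) ∧ (z ≤ᵇ y (suc m)) ∧ chain y m z zs

valid : (ℕ → ℕ) → (n : ℕ) → Vec ℕ n → Bool
valid y zero    []       = true
valid y (suc m) (x ∷ xs) = (x ≤ᵇ y (suc m)) ∧ chain y m x xs

box : ℕ → (n : ℕ) → List (Vec ℕ n)
box b zero    = [ [] ]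
box b (suc n) = concatMap (λ x → map (x ∷_) (box b n)) (upTo (suc b))

headIs : ℕ → {n : ℕ} → Vec ℕ n → Bool
headIs k []      = false
headIs k (x ∷ _) = (x ≤ᵇ k) ∧ (k ≤ᵇ x)

-- A(n,k) : number of valid n-tuples with x_1 = k.
-- Every valid tuple has all entries ≤ x_1 ≤ y_n, so enumerating {0..y_n}^n is exhaustive.
A : (ℕ → ℕ) → ℕ → ℕ → ℕ
A y n k = length (filterᵇ (λ xs → valid y n xs ∧ headIs k xs) (box (y n) n))

sumRange : ℕ → ℕ → (ℕ → ℕ) → ℕ
sumRange a zero      f = 0
sumRange a (suc len) f = f a ℕ.+ sumRange (suc a) len f

sumRangeℚ : ℕ → ℕ → (ℕ → ℚ) → ℚ
sumRangeℚ a zero      f = 0ℚ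
sumRangeℚ a (suc len) f = f a + sumRangeℚ (suc a) len f

W : (ℕ → ℕ) → ℕ → ℕ
W y n = sumRange 0 (suc (y n)) (A y n)

T : (ℕ → ℕ) → ℕ → ℚ
T y n = ((1ℚ + ⟦ y n ⟧ - ⟦ y (n ∸ 1) ⟧) * ⟦ W y (n ∸ 1) ⟧) ÷ₜ ⟦ W y n ⟧

M : (ℕ → ℕ) → ℕ → ℚ
M y n = sumRangeℚ 1 ((y (n ∸ 1) ∸ y (n ∸ 2)) ℕ.+ 1)
          (λ k → ⟦ W y (n ∸ 1) ⟧ - ⟦ k ⟧ * ⟦ W y (n ∸ 2) ⟧)
        ÷ₜ ⟦ W y n ⟧

S : (ℕ → ℕ) → ℕ → ℚ
S y n = 1ℚ - M y n - T y n

catalan : ℕ → ℚ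
catalan m = ((+ 1) Data.Rational./ suc m) * ⟦ (2 ℕ.* m) C m ⟧

ConvergesTo : (ℕ → ℚ) → ℚ → Set
ConvergesTo a L = ∀ ε → ε > 0ℚ → ∃ λ N → ∀ n → N ℕ.≤ n → ∣ a n - L ∣ < ε

yId : ℕ → ℕ
yId n = n

{-# OPTIONS --safe #-}

-- For y_n = n a valid n-tuple is a weakly decreasing chain whose i-th entry is at most n + 1 - i.
-- Counting such chains by their first entry, B(m, k) = A(m + 1, k) satisfies the Pascal-type recurrence
-- B(m + 1, k + 1) = B(m + 1, k) + B(m, k + 1), and so does the ballot number C(n + k, k) - C(n + k, k - 1)
-- with n = m + 1, because both binomials obey Pascal's rule; the boundary value B(m + 1, m + 2) = B(m + 1, m + 1)
-- is matched by the symmetry of C(2m + 3, -). Hence A(n, k) is a ballot number and W(n) = A(n + 1, n) is the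
-- Catalan number C_(n+1). The Catalan recurrence (n + 2) W(n) = 2 (2n + 1) W(n - 1) turns T, M and S into
-- rational functions of n whose distances to 1/2, 5/16 and 3/16 are at most 1/n from n = 5 on.

module Submission where

open import Defs
open import Data.Nat using (ℕ)

module Counting where

  open import Data.Bool using (Bool; true; false; _∧_; if_then_else_)
  open import Data.Bool.Properties using (∧-comm; T-≡)
  open import Data.Nat using (ℕ; zero; suc; _+_; _≤_; _<_; _≤ᵇ_; _<ᵇ_; s≤s)
  open import Data.Nat.Properties
  open import Data.Nat.ListAction using (sum)
  open import Data.Nat.ListAction.Properties using (sum-++)
  open import Data.List using (List; []; _∷_; [_]; _++_; _∷ʳ_; map; concatMap; filterᵇ; length; upTo)
  open import Data.List.Properties using (filter-++; length-++; map-++; map-cong; applyUpTo-∷ʳ)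
  open import Data.Vec using (Vec; []; _∷_)
  open import Data.Sum using (inj₁; inj₂)
  open import Function using (_∘_; id; Equivalence)
  open import Relation.Binary.Definitions using (tri<; tri≈; tri>)
  open import Relation.Binary.PropositionalEquality hiding ([_])
  open import Relation.Nullary using (contradiction)
  open import Relation.Nullary.Decidable using (T?)

  ≤ᵇ-true : ∀ {m n} → m ≤ n → (m ≤ᵇ n) ≡ true
  ≤ᵇ-true m≤n = Equivalence.to T-≡ (≤⇒≤ᵇ m≤n)

  ≤ᵇ-false : ∀ {m n} → n < m → (m ≤ᵇ n) ≡ false
  ≤ᵇ-false {m} {n} n<m with m ≤ᵇ n in eq
  ... | false = refl
  ... | true  = contradiction (≤ᵇ⇒≤ m n (Equivalence.from T-≡ eq)) (<⇒≱ n<m)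

  <ᵇ-suc : ∀ m n → (m <ᵇ suc n) ≡ (m ≤ᵇ n)
  <ᵇ-suc zero    n = refl
  <ᵇ-suc (suc m) n = refl

  countᵇ : {X : Set} → (X → Bool) → List X → ℕ
  countᵇ P xs = length (filterᵇ P xs)

  module _ {X : Set} where

    countᵇ-++ : ∀ (P : X → Bool) xs ys → countᵇ P (xs ++ ys) ≡ countᵇ P xs + countᵇ P ys
    countᵇ-++ P xs ys = trans (cong length (filter-++ (T? ∘ P) xs ys)) (length-++ (filterᵇ P xs))

    countᵇ-cong : ∀ {P Q : X → Bool} → (∀ x → P x ≡ Q x) → ∀ xs → countᵇ P xs ≡ countᵇ Q xs
    countᵇ-cong P≗Q [] = refl
    countᵇ-cong {P} {Q} P≗Q (x ∷ xs) with P x | Q x | P≗Q x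
    ... | true  | .true  | refl = cong suc (countᵇ-cong P≗Q xs)
    ... | false | .false | refl = countᵇ-cong P≗Q xs

    countᵇ-false : ∀ (xs : List X) → countᵇ (λ _ → false) xs ≡ 0
    countᵇ-false []       = refl
    countᵇ-false (x ∷ xs) = countᵇ-false xs

    countᵇ-guard : ∀ c (P : X → Bool) xs → countᵇ (λ x → c ∧ P x) xs ≡ (if c then countᵇ P xs else 0)
    countᵇ-guard true  P xs = refl
    countᵇ-guard false P xs = countᵇ-false xs

    countᵇ-map : ∀ {B : Set} (P : B → Bool) (f : X → B) xs → countᵇ P (map f xs) ≡ countᵇ (P ∘ f) xs
    countᵇ-map P f []       = refl
    countᵇ-map P f (x ∷ xs) with P (f x)
    ... | true  = cong suc (countᵇ-map P f xs)
    ... | false = countᵇ-map P f xs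

    countᵇ-concatMap : ∀ {B : Set} (P : X → Bool) (f : B → List X) xs →
                       countᵇ P (concatMap f xs) ≡ sum (map (countᵇ P ∘ f) xs)
    countᵇ-concatMap P f []       = refl
    countᵇ-concatMap P f (x ∷ xs) =
      trans (countᵇ-++ P (f x) (concatMap f xs)) (cong (countᵇ P (f x) +_) (countᵇ-concatMap P f xs))

  sumRange-snoc : ∀ a n f → sumRange a (suc n) f ≡ sumRange a n f + f (a + n)
  sumRange-snoc a zero    f = trans (+-identityʳ (f a)) (cong f (sym (+-identityʳ a)))
  sumRange-snoc a (suc n) f = begin
    f a + sumRange (suc a) (suc n) f               ≡⟨ cong (f a +_) (sumRange-snoc (suc a) n f) ⟩
    f a + (sumRange (suc a) n f + f (suc a + n))   ≡⟨ +-assoc (f a) _ _ ⟨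
    f a + sumRange (suc a) n f + f (suc (a + n))   ≡⟨ cong (λ i → f a + sumRange (suc a) n f + f i) (+-suc a n) ⟨
    f a + sumRange (suc a) n f + f (a + suc n)     ∎
    where open ≡-Reasoning

  sumRange-cong : ∀ n {f g} → (∀ i → i < n → f i ≡ g i) → sumRange 0 n f ≡ sumRange 0 n g
  sumRange-cong zero    f≗g = refl
  sumRange-cong (suc n) {f} {g} f≗g = begin
    sumRange 0 (suc n) f  ≡⟨ sumRange-snoc 0 n f ⟩
    sumRange 0 n f + f n  ≡⟨ cong₂ _+_ (sumRange-cong n (λ i i<n → f≗g i (m<n⇒m<1+n i<n))) (f≗g n ≤-refl) ⟩
    sumRange 0 n g + g n  ≡⟨ sumRange-snoc 0 n g ⟨
    sumRange 0 (suc n) g  ∎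
    where open ≡-Reasoning

  sum-upTo : ∀ n (h : ℕ → ℕ) → sum (map h (upTo n)) ≡ sumRange 0 n h
  sum-upTo zero    h = refl
  sum-upTo (suc n) h = begin
    sum (map h (upTo (suc n)))         ≡⟨ cong (sum ∘ map h) (applyUpTo-∷ʳ id n) ⟨
    sum (map h (upTo n ∷ʳ n))          ≡⟨ cong sum (map-++ h (upTo n) [ n ]) ⟩
    sum (map h (upTo n) ++ [ h n ])    ≡⟨ sum-++ (map h (upTo n)) [ h n ] ⟩
    sum (map h (upTo n)) + (h n + 0)   ≡⟨ cong₂ _+_ (sum-upTo n h) (+-identityʳ (h n)) ⟩
    sumRange 0 n h + h n               ≡⟨ sumRange-snoc 0 n h ⟨
    sumRange 0 (suc n) h               ∎
    where open ≡-Reasoning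

  sumRange-truncate : ∀ {p b} f → p ≤ b →
                   sumRange 0 (suc b) (λ z → if z ≤ᵇ p then f z else 0) ≡ sumRange 0 (suc p) f
  sumRange-truncate {p} {b} f p≤b with m≤n⇒m<n∨m≡n p≤b
  ... | inj₂ refl = sumRange-cong (suc p) λ z z≤p → cong (λ c → if c then f z else 0) (≤ᵇ-true (≤-pred z≤p))
  ... | inj₁ (s≤s {n = b′} p≤b′) = begin
    sumRange 0 (suc (suc b′)) g         ≡⟨ sumRange-snoc 0 (suc b′) g ⟩
    sumRange 0 (suc b′) g + g (suc b′)  ≡⟨ cong₂ _+_ (sumRange-truncate f p≤b′) (cong (λ c → if c then f (suc b′) else 0) (≤ᵇ-false (s≤s p≤b′))) ⟩
    sumRange 0 (suc p) f + 0            ≡⟨ +-identityʳ _ ⟩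
    sumRange 0 (suc p) f                ∎
    where
    open ≡-Reasoning
    g = λ z → if z ≤ᵇ p then f z else 0

  sumRange-δ : ∀ n k (g : ℕ → ℕ) →
               sumRange 0 n (λ x → if (x ≤ᵇ k) ∧ (k ≤ᵇ x) then g x else 0) ≡ (if k <ᵇ n then g k else 0)
  sumRange-δ zero    k g = refl
  sumRange-δ (suc n) k g rewrite sumRange-snoc 0 n (λ x → if (x ≤ᵇ k) ∧ (k ≤ᵇ x) then g x else 0)
                               | sumRange-δ n k g with <-cmp k n
  ... | tri< k<n _ _ rewrite ≤ᵇ-true k<n | ≤ᵇ-false k<n | ≤ᵇ-true (m<n⇒m<1+n k<n) = +-identityʳ (g k)
  ... | tri≈ _ refl _ rewrite ≤ᵇ-false (n<1+n k) | ≤ᵇ-true (≤-refl {k}) | ≤ᵇ-true (n<1+n k) = refl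
  ... | tri> _ _ n<k rewrite ≤ᵇ-false n<k | ≤ᵇ-true (<⇒≤ n<k) | ≤ᵇ-false (m<n⇒m<1+n n<k) | ≤ᵇ-false (s≤s n<k) = refl

  countᵇ-box : ∀ b m (P : Vec ℕ (suc m) → Bool) →
               countᵇ P (box b (suc m)) ≡ sumRange 0 (suc b) (λ x → countᵇ (P ∘ (x ∷_)) (box b m))
  countᵇ-box b m P = begin
    countᵇ P (box b (suc m))
      ≡⟨ countᵇ-concatMap P (λ x → map (x ∷_) (box b m)) (upTo (suc b)) ⟩
    sum (map (λ x → countᵇ P (map (x ∷_) (box b m))) (upTo (suc b)))
      ≡⟨ cong sum (map-cong (λ x → countᵇ-map P (x ∷_) (box b m)) (upTo (suc b))) ⟩
    sum (map (λ x → countᵇ (P ∘ (x ∷_)) (box b m)) (upTo (suc b)))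
      ≡⟨ sum-upTo (suc b) _ ⟩
    sumRange 0 (suc b) (λ x → countᵇ (P ∘ (x ∷_)) (box b m)) ∎
    where open ≡-Reasoning

  chains : (ℕ → ℕ) → ℕ → ℕ → ℕ
  chains y zero    p = 1
  chains y (suc m) p = sumRange 0 (suc p) λ z → if z ≤ᵇ y (suc m) then chains y m z else 0

  countᵇ-chain : ∀ y m {p b} → p ≤ b → countᵇ (chain y m p) (box b m) ≡ chains y m p
  countᵇ-chain y zero    p≤b = refl
  countᵇ-chain y (suc m) {p} {b} p≤b = begin
    countᵇ (chain y (suc m) p) (box b (suc m))
      ≡⟨ countᵇ-box b m (chain y (suc m) p) ⟩
    sumRange 0 (suc b) (λ z → countᵇ (λ v → (z ≤ᵇ p) ∧ (z ≤ᵇ y (suc m)) ∧ chain y m z v) (box b m))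
      ≡⟨ sumRange-cong (suc b) (λ z z≤b → guarded z (≤-pred z≤b)) ⟩
    sumRange 0 (suc b) (λ z → if z ≤ᵇ p then (if z ≤ᵇ y (suc m) then chains y m z else 0) else 0)
      ≡⟨ sumRange-truncate _ p≤b ⟩
    chains y (suc m) p ∎
    where
    open ≡-Reasoning
    guarded : ∀ z → z ≤ b →
              countᵇ (λ v → (z ≤ᵇ p) ∧ (z ≤ᵇ y (suc m)) ∧ chain y m z v) (box b m)
              ≡ (if z ≤ᵇ p then (if z ≤ᵇ y (suc m) then chains y m z else 0) else 0)
    guarded z z≤b =
      trans (countᵇ-guard (z ≤ᵇ p) _ (box b m)) (cong (λ c → if z ≤ᵇ p then c else 0)
        (trans (countᵇ-guard (z ≤ᵇ y (suc m)) _ (box b m)) (cong (λ c → if z ≤ᵇ y (suc m) then c else 0)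
          (countᵇ-chain y m z≤b))))

  A-suc : ∀ y m k → A y (suc m) k ≡ (if k ≤ᵇ y (suc m) then chains y m k else 0)
  A-suc y m k = begin
    A y (suc m) k
      ≡⟨ countᵇ-box Y m _ ⟩
    sumRange 0 (suc Y) (λ x → countᵇ (λ v → ((x ≤ᵇ Y) ∧ chain y m x v) ∧ ((x ≤ᵇ k) ∧ (k ≤ᵇ x))) (box Y m))
      ≡⟨ sumRange-cong (suc Y) (λ x x≤Y → headed x (≤-pred x≤Y)) ⟩
    sumRange 0 (suc Y) (λ x → if (x ≤ᵇ k) ∧ (k ≤ᵇ x) then chains y m x else 0)
      ≡⟨ sumRange-δ (suc Y) k (chains y m) ⟩
    (if k <ᵇ suc Y then chains y m k else 0)
      ≡⟨ cong (λ c → if c then chains y m k else 0) (<ᵇ-suc k Y) ⟩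
    (if k ≤ᵇ Y then chains y m k else 0) ∎
    where
    open ≡-Reasoning
    Y = y (suc m)
    headed : ∀ x → x ≤ Y →
             countᵇ (λ v → ((x ≤ᵇ Y) ∧ chain y m x v) ∧ ((x ≤ᵇ k) ∧ (k ≤ᵇ x))) (box Y m)
             ≡ (if (x ≤ᵇ k) ∧ (k ≤ᵇ x) then chains y m x else 0)
    headed x x≤Y = begin
      countᵇ (λ v → ((x ≤ᵇ Y) ∧ chain y m x v) ∧ isK) (box Y m)
        ≡⟨ countᵇ-cong (λ v → trans (cong (λ c → (c ∧ chain y m x v) ∧ isK) (≤ᵇ-true x≤Y))
                                    (∧-comm (chain y m x v) isK)) (box Y m) ⟩
      countᵇ (λ v → isK ∧ chain y m x v) (box Y m)
        ≡⟨ countᵇ-guard isK (chain y m x) (box Y m) ⟩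
      (if isK then countᵇ (chain y m x) (box Y m) else 0)
        ≡⟨ cong (λ c → if isK then c else 0) (countᵇ-chain y m x≤Y) ⟩
      (if isK then chains y m x else 0) ∎
      where isK = (x ≤ᵇ k) ∧ (k ≤ᵇ x)

  W-suc : ∀ y m → W y (suc m) ≡ chains y (suc m) (y (suc m))
  W-suc y m = sumRange-cong (suc (y (suc m))) λ k _ → A-suc y m k

  chains-zero : ∀ y m → chains y m 0 ≡ 1
  chains-zero y zero    = refl
  chains-zero y (suc m) = trans (+-identityʳ _) (chains-zero y m)

  chains-suc : ∀ y m p → chains y (suc m) (suc p)
               ≡ chains y (suc m) p + (if suc p ≤ᵇ y (suc m) then chains y m (suc p) else 0)
  chains-suc y m p = sumRange-snoc 0 (suc p) λ z → if z ≤ᵇ y (suc m) then chains y m z else 0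

module Ballot where

  open Counting
  open import Data.Bool using (if_then_else_)
  open import Data.Nat using (ℕ; zero; suc; _+_; _*_; _∸_; _≤_; _<_; s≤s)
  open import Data.Nat.Properties
  open import Data.Nat.Combinatorics using (_C_; nCk+nC[k+1]≡[n+1]C[k+1]; nCk≡nC[n∸k]; nC1≡n)
  open import Data.Nat.Tactic.RingSolver using (solve-∀)
  open import Data.Sum using (inj₁; inj₂)
  open import Relation.Binary.PropositionalEquality

  pascal : ∀ n k → n C k + n C suc k ≡ suc n C suc k
  pascal = nCk+nC[k+1]≡[n+1]C[k+1]

  C-sym : ∀ a b → (a + b) C a ≡ (a + b) C b
  C-sym a b = trans (nCk≡nC[n∸k] (m≤m+n a b)) (cong ((a + b) C_) (m+n∸m≡n a b))

  absorption : ∀ n k → suc k * (suc n C suc k) ≡ suc n * (n C k)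
  absorption zero    zero    = refl
  absorption zero    (suc k) = *-zeroʳ (suc (suc k))
  absorption (suc n) zero    = trans (+-identityʳ _) (trans (nC1≡n (suc (suc n))) (sym (*-identityʳ (suc (suc n)))))
  absorption (suc n) (suc k) = begin
    suc (suc k) * (suc (suc n) C suc (suc k))                 ≡⟨ cong (suc (suc k) *_) (pascal (suc n) (suc k)) ⟨
    suc (suc k) * (c₁ + suc n C suc (suc k))                  ≡⟨ regroup₁ k c₁ (suc n C suc (suc k)) ⟩
    suc k * c₁ + c₁ + suc (suc k) * (suc n C suc (suc k))      ≡⟨ cong₂ (λ a b → a + c₁ + b) (absorption n k) (absorption n (suc k)) ⟩
    suc n * (n C k) + c₁ + suc n * (n C suc k)                 ≡⟨ regroup₂ n (n C k) c₁ (n C suc k) ⟩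
    suc n * (n C k + n C suc k) + c₁                           ≡⟨ cong (λ a → suc n * a + c₁) (pascal n k) ⟩
    suc n * c₁ + c₁                                            ≡⟨ +-comm (suc n * c₁) c₁ ⟩
    suc (suc n) * c₁                                           ∎
    where
    open ≡-Reasoning
    c₁ = suc n C suc k
    regroup₁ : ∀ k a b → suc (suc k) * (a + b) ≡ suc k * a + a + suc (suc k) * b
    regroup₁ = solve-∀
    regroup₂ : ∀ n a c b → suc n * a + c + suc n * b ≡ suc n * (a + b) + c
    regroup₂ = solve-∀

  infixl 6.5 _C⁻_
  _C⁻_ : ℕ → ℕ → ℕ
  n C⁻ zero  = 0
  n C⁻ suc k = n C k

  pascal⁻ : ∀ n k → suc n C k ≡ n C k + n C⁻ k
  pascal⁻ n zero    = refl
  pascal⁻ n (suc k) = trans (sym (pascal n k)) (+-comm (n C k) (n C suc k))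

  upper-absorption : ∀ n k → suc n * (suc (n + k) C k) ≡ suc (n + k) * ((n + k) C k)
  C⁻-absorption    : ∀ n k → suc n * ((n + k) C⁻ k) ≡ k * ((n + k) C k)

  upper-absorption n zero    = cong (λ m → suc m * 1) (sym (+-identityʳ n))
  upper-absorption n (suc k) = begin
    suc n * (suc N C suc k)                   ≡⟨ cong (suc n *_) (pascal N k) ⟨
    suc n * (N C k + N C suc k)               ≡⟨ *-distribˡ-+ (suc n) (N C k) (N C suc k) ⟩
    suc n * (N C k) + suc n * (N C suc k)     ≡⟨ cong (_+ suc n * (N C suc k)) (C⁻-absorption n (suc k)) ⟩
    suc k * (N C suc k) + suc n * (N C suc k) ≡⟨ *-distribʳ-+ (N C suc k) (suc k) (suc n) ⟨
    (suc k + suc n) * (N C suc k)             ≡⟨ cong (λ a → suc a * (N C suc k)) (trans (+-comm k (suc n)) (sym (+-suc n k))) ⟩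
    suc N * (N C suc k)                       ∎
    where
    open ≡-Reasoning
    N = n + suc k

  C⁻-absorption n zero    = *-zeroʳ (suc n)
  C⁻-absorption n (suc k) = subst (λ N → suc n * (N C k) ≡ suc k * (N C suc k)) (sym (+-suc n k))
    (trans (upper-absorption n k) (sym (absorption (n + k) k)))

  ballot-step : ∀ N b₁ b₂ k → b₁ + N C⁻ k ≡ N C k → b₂ + N C k ≡ N C suc k →
                (b₁ + b₂) + suc N C k ≡ suc N C suc k
  ballot-step N b₁ b₂ k h₁ h₂ = begin
    (b₁ + b₂) + suc N C k                ≡⟨ cong ((b₁ + b₂) +_) (pascal⁻ N k) ⟩
    (b₁ + b₂) + (N C k + N C⁻ k)         ≡⟨ regroup b₁ b₂ (N C k) (N C⁻ k) ⟩
    (b₁ + N C⁻ k) + (b₂ + N C k)         ≡⟨ cong₂ _+_ h₁ h₂ ⟩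
    N C k + N C suc k                    ≡⟨ pascal N k ⟩
    suc N C suc k                        ∎
    where
    open ≡-Reasoning
    regroup : ∀ a b c d → (a + b) + (c + d) ≡ (a + d) + (b + c)
    regroup = solve-∀

  ballot-top : ∀ m b → let N = suc (suc m) + suc m in
               b + N C m ≡ N C suc m → b + suc N C suc m ≡ suc N C suc (suc m)
  ballot-top m b h = begin
    b + suc N C suc m                    ≡⟨ cong (b +_) (pascal⁻ N (suc m)) ⟩
    b + (N C suc m + N C m)              ≡⟨ regroup b (N C suc m) (N C m) ⟩
    (b + N C m) + N C suc m              ≡⟨ cong (_+ N C suc m) h ⟩
    N C suc m + N C suc m                ≡⟨ cong (N C suc m +_) (C-sym (suc (suc m)) (suc m)) ⟨
    N C suc m + N C suc (suc m)          ≡⟨ pascal N (suc m) ⟩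
    suc N C suc (suc m)                  ∎
    where
    open ≡-Reasoning
    N = suc (suc m) + suc m
    regroup : ∀ a b c → a + (b + c) ≡ (a + c) + b
    regroup = solve-∀

  -- The ballot number C(n + k, k) - C(n + k, k - 1), n = m + 1, in additive form to avoid truncated subtraction.
  ballot : ∀ m k → k ≤ suc m → chains yId m k + (suc m + k) C⁻ k ≡ (suc m + k) C k
  ballot m       zero          _ = trans (+-identityʳ _) (chains-zero yId m)
  ballot zero    (suc zero)    _ = refl
  ballot zero    (suc (suc k)) (s≤s ())
  ballot (suc m) (suc k) k≤ with m≤n⇒m<n∨m≡n (≤-pred k≤)
  ... | inj₁ k<sm = begin
    chains yId (suc m) (suc k) + (suc (suc m) + suc k) C k
      ≡⟨ cong₂ _+_ rec (cong (_C k) (+-suc (suc (suc m)) k)) ⟩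
    (chains yId (suc m) k + chains yId m (suc k)) + suc N C k
      ≡⟨ ballot-step N _ _ k (ballot (suc m) k (<⇒≤ (m<n⇒m<1+n k<sm))) below ⟩
    suc N C suc k
      ≡⟨ cong (_C suc k) (+-suc (suc (suc m)) k) ⟨
    (suc (suc m) + suc k) C suc k ∎
    where
    open ≡-Reasoning
    N = suc (suc m) + k
    rec : chains yId (suc m) (suc k) ≡ chains yId (suc m) k + chains yId m (suc k)
    rec = trans (chains-suc yId m k) (cong (λ c → chains yId (suc m) k + (if c then chains yId m (suc k) else 0)) (≤ᵇ-true k<sm))
    below : chains yId m (suc k) + N C k ≡ N C suc k
    below = subst (λ M → chains yId m (suc k) + M C k ≡ M C suc k) (+-suc (suc m) k) (ballot m (suc k) k<sm)
  ... | inj₂ refl = begin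
    chains yId (suc m) (suc (suc m)) + (suc (suc m) + suc (suc m)) C suc m
      ≡⟨ cong₂ _+_ top (cong (_C suc m) (+-suc (suc (suc m)) (suc m))) ⟩
    chains yId (suc m) (suc m) + suc N C suc m
      ≡⟨ ballot-top m _ (ballot (suc m) (suc m) (n≤1+n (suc m))) ⟩
    suc N C suc (suc m)
      ≡⟨ cong (_C suc (suc m)) (+-suc (suc (suc m)) (suc m)) ⟨
    (suc (suc m) + suc (suc m)) C suc (suc m) ∎
    where
    open ≡-Reasoning
    N = suc (suc m) + suc m
    top : chains yId (suc m) (suc (suc m)) ≡ chains yId (suc m) (suc m)
    top = trans (chains-suc yId m (suc m))
            (trans (cong (λ c → chains yId (suc m) (suc m) + (if c then chains yId m (suc (suc m)) else 0))
                         (≤ᵇ-false (n<1+n (suc m))))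
                   (+-identityʳ _))

  ballot-closed : ∀ m k → k ≤ suc m → chains yId m k * suc (suc m) ≡ (suc m ∸ k + 1) * ((suc m + k) C k)
  ballot-closed m k k≤ = +-cancelʳ-≡ (k * c) _ _ (begin
    b * suc n + k * c               ≡⟨ cong₂ _+_ (*-comm b (suc n)) (sym (C⁻-absorption n k)) ⟩
    suc n * b + suc n * ((n + k) C⁻ k) ≡⟨ *-distribˡ-+ (suc n) b _ ⟨
    suc n * (b + (n + k) C⁻ k)       ≡⟨ cong (suc n *_) (ballot m k k≤) ⟩
    suc n * c                        ≡⟨ cong (_* c) split ⟩
    (n ∸ k + 1 + k) * c              ≡⟨ *-distribʳ-+ c (n ∸ k + 1) k ⟩
    (n ∸ k + 1) * c + k * c          ∎)
    where
    open ≡-Reasoning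
    n = suc m
    b = chains yId m k
    c = (n + k) C k
    shift : ∀ a b → suc (a + b) ≡ a + 1 + b
    shift = solve-∀
    split : suc n ≡ n ∸ k + 1 + k
    split = trans (cong suc (sym (m∸n+n≡m k≤))) (shift (n ∸ k) k)

  A-yId : ∀ m k → k ≤ suc m → A yId (suc m) k ≡ chains yId m k
  A-yId m k k≤ = trans (A-suc yId m k) (cong (λ c → if c then chains yId m k else 0) (≤ᵇ-true k≤))

  A-yId-beyond : ∀ m k → suc m < k → A yId (suc m) k ≡ 0
  A-yId-beyond m k lt = trans (A-suc yId m k) (cong (λ c → if c then chains yId m k else 0) (≤ᵇ-false lt))

  A-closed : ∀ n k → 1 ≤ n → k ≤ n → A yId n k * suc n ≡ (n ∸ k + 1) * ((n + k) C k)
  A-closed (suc m) k _ k≤ = trans (cong (_* suc (suc m)) (A-yId m k k≤)) (ballot-closed m k k≤)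

  oddCentral : ℕ → ℕ
  oddCentral n = (suc n + n) C n

  central-suc : ∀ n → (suc n + suc n) C suc n ≡ 2 * oddCentral n
  central-suc n = begin
    (suc n + suc n) C suc n     ≡⟨ cong (_C suc n) (+-suc (suc n) n) ⟩
    suc (suc n + n) C suc n     ≡⟨ pascal (suc n + n) n ⟨
    D + (suc n + n) C suc n     ≡⟨ cong (D +_) (C-sym (suc n) n) ⟩
    D + D                       ≡⟨ cong (D +_) (+-identityʳ D) ⟨
    2 * D                       ∎
    where
    open ≡-Reasoning
    D = oddCentral n

  oddCentral-rec : ∀ n → suc (suc n) * oddCentral (suc n) ≡ (suc (suc n) + suc n) * (2 * oddCentral n)
  oddCentral-rec n = begin
    suc (suc n) * (N C suc n)                ≡⟨ cong (suc (suc n) *_) (C-sym (suc (suc n)) (suc n)) ⟨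
    suc (suc n) * (N C suc (suc n))          ≡⟨ absorption (suc n + suc n) (suc n) ⟩
    N * ((suc n + suc n) C suc n)            ≡⟨ cong (N *_) (central-suc n) ⟩
    N * (2 * oddCentral n)                   ∎
    where
    open ≡-Reasoning
    N = suc (suc n) + suc n

  W-oddCentral : ∀ m → W yId (suc m) * suc (suc (suc m)) ≡ 2 * oddCentral (suc m)
  W-oddCentral m = begin
    W yId (suc m) * suc (suc (suc m))                ≡⟨ cong (_* suc (suc (suc m))) (W-suc yId m) ⟩
    chains yId (suc m) (suc m) * suc (suc (suc m))   ≡⟨ ballot-closed (suc m) (suc m) (n≤1+n (suc m)) ⟩
    (suc m ∸ m + 1) * oddCentral (suc m)             ≡⟨ cong (λ a → (a + 1) * oddCentral (suc m)) (m+n∸n≡m 1 m) ⟩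
    2 * oddCentral (suc m)                           ∎
    where open ≡-Reasoning

  W-catalan : ∀ n → 1 ≤ n → W yId n * suc (n + 1) ≡ (2 * (n + 1)) C (n + 1)
  W-catalan (suc m) _ = subst (λ k → W yId (suc m) * suc k ≡ (2 * k) C k) (+-comm 1 (suc m)) (begin
    W yId (suc m) * suc (suc (suc m))        ≡⟨ W-oddCentral m ⟩
    2 * oddCentral (suc m)                   ≡⟨ central-suc (suc m) ⟨
    (suc (suc m) + suc (suc m)) C suc (suc m) ≡⟨ cong (λ a → (suc (suc m) + a) C suc (suc m)) (+-identityʳ (suc (suc m))) ⟨
    (2 * suc (suc m)) C suc (suc m)          ∎)
    where open ≡-Reasoning

  W-rec : ∀ n → 2 ≤ n → (n + 2) * W yId n ≡ 2 * (2 * n + 1) * W yId (n ∸ 1)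
  W-rec (suc zero)      (s≤s ())
  W-rec n@(suc (suc m)) _ = *-cancelˡ-≡ _ _ (suc n) (begin
    suc n * ((n + 2) * W₂)                       ≡⟨ cong (suc n *_) (commute n W₂) ⟩
    suc n * (W₂ * suc (suc n))                   ≡⟨ cong (suc n *_) (W-oddCentral (suc m)) ⟩
    suc n * (2 * oddCentral n)                   ≡⟨ swap (suc n) (oddCentral n) ⟩
    2 * (suc n * oddCentral n)                   ≡⟨ cong (2 *_) (oddCentral-rec (suc m)) ⟩
    2 * ((suc n + n) * (2 * oddCentral (suc m))) ≡⟨ cong (λ a → 2 * ((suc n + n) * a)) (W-oddCentral m) ⟨
    2 * ((suc n + n) * (W₁ * suc n))             ≡⟨ collect n W₁ ⟩
    suc n * (2 * (2 * n + 1) * W₁)               ∎)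
    where
    open ≡-Reasoning
    W₁ = W yId (suc m)
    W₂ = W yId n
    commute : ∀ n w → (n + 2) * w ≡ w * suc (suc n)
    commute = solve-∀
    swap : ∀ a b → a * (2 * b) ≡ 2 * (a * b)
    swap = solve-∀
    collect : ∀ n w → 2 * ((suc n + n) * (w * suc n)) ≡ suc n * (2 * (2 * n + 1) * w)
    collect = solve-∀

module RationalArithmetic where

  open Counting using (chains-zero)
  open Ballot using (A-yId; W-rec)
  open import Level using (0ℓ)
  open import Data.Maybe using (Maybe; just; nothing)
  open import Data.Nat as ℕ using (ℕ; zero; suc; z≤n; s≤s; _∸_)
  import Data.Nat.Properties as ℕ
  open import Data.Integer as ℤ using (+_; +≤+; +<+; +[1+_]; +0; -[1+_])
  import Data.Integer.Properties as ℤ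
  import Data.Integer.Tactic.RingSolver as ℤ-Solver
  open import Data.Rational using (ℚ; 0ℚ; 1ℚ; _+_; _*_; _-_; _/_; 1/_; ∣_∣; _≤_; _<_; _>_; toℚᵘ; mkℚ; ≢-nonZero; positive)
  open import Data.Rational.Properties
  import Data.Rational.Unnormalised as ℚᵘ
  import Data.Rational.Unnormalised.Properties as ℚᵘ
  open import Data.Product using (Σ; _,_)
  open import Relation.Binary.PropositionalEquality
  open import Relation.Nullary using (yes; no; contradiction)
  open import Tactic.RingSolver using (solve-∀)
  import Tactic.RingSolver.Core.AlmostCommutativeRing as ACR

  0≟_ : (p : ℚ) → Maybe (0ℚ ≡ p)
  0≟ p with 0ℚ ≟ p
  ... | yes 0≡p = just 0≡p
  ... | no  _   = nothing

  ℚ-ring : ACR.AlmostCommutativeRing 0ℓ 0ℓ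
  ℚ-ring = ACR.fromCommutativeRing +-*-commutativeRing 0≟_

  ⟦⟧ᵘ : ∀ n → toℚᵘ ⟦ n ⟧ ℚᵘ.≃ ℚᵘ.mkℚᵘ (+ n) 0
  ⟦⟧ᵘ n = toℚᵘ-fromℚᵘ (ℚᵘ.mkℚᵘ (+ n) 0)

  ⟦+⟧ : ∀ a b → ⟦ a ℕ.+ b ⟧ ≡ ⟦ a ⟧ + ⟦ b ⟧
  ⟦+⟧ a b = toℚᵘ-injective (begin
    toℚᵘ ⟦ a ℕ.+ b ⟧                         ≈⟨ ⟦⟧ᵘ (a ℕ.+ b) ⟩
    ℚᵘ.mkℚᵘ (+ (a ℕ.+ b)) 0                  ≈⟨ ℚᵘ.*≡* (trans (cong (ℤ._* + 1) (ℤ.pos-+ a b)) (sum-as-fraction (+ a) (+ b))) ⟩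
    ℚᵘ.mkℚᵘ (+ a) 0 ℚᵘ.+ ℚᵘ.mkℚᵘ (+ b) 0      ≈⟨ ℚᵘ.+-cong (⟦⟧ᵘ a) (⟦⟧ᵘ b) ⟨
    toℚᵘ ⟦ a ⟧ ℚᵘ.+ toℚᵘ ⟦ b ⟧                ≈⟨ toℚᵘ-homo-+ ⟦ a ⟧ ⟦ b ⟧ ⟨
    toℚᵘ (⟦ a ⟧ + ⟦ b ⟧)                      ∎)
    where
    open ℚᵘ.≃-Reasoning
    sum-as-fraction : ∀ x y → (x ℤ.+ y) ℤ.* + 1 ≡ (x ℤ.* + 1 ℤ.+ y ℤ.* + 1) ℤ.* + 1
    sum-as-fraction = ℤ-Solver.solve-∀

  ⟦*⟧ : ∀ a b → ⟦ a ℕ.* b ⟧ ≡ ⟦ a ⟧ * ⟦ b ⟧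
  ⟦*⟧ a b = toℚᵘ-injective (begin
    toℚᵘ ⟦ a ℕ.* b ⟧                         ≈⟨ ⟦⟧ᵘ (a ℕ.* b) ⟩
    ℚᵘ.mkℚᵘ (+ (a ℕ.* b)) 0                  ≈⟨ ℚᵘ.*≡* (cong (ℤ._* + 1) (ℤ.pos-* a b)) ⟩
    ℚᵘ.mkℚᵘ (+ a) 0 ℚᵘ.* ℚᵘ.mkℚᵘ (+ b) 0      ≈⟨ ℚᵘ.*-cong (⟦⟧ᵘ a) (⟦⟧ᵘ b) ⟨
    toℚᵘ ⟦ a ⟧ ℚᵘ.* toℚᵘ ⟦ b ⟧                ≈⟨ toℚᵘ-homo-* ⟦ a ⟧ ⟦ b ⟧ ⟨
    toℚᵘ (⟦ a ⟧ * ⟦ b ⟧)                      ∎)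
    where open ℚᵘ.≃-Reasoning

  ⟦⟧-mono-≤ : ∀ {m n} → m ℕ.≤ n → ⟦ m ⟧ ≤ ⟦ n ⟧
  ⟦⟧-mono-≤ {m} {n} m≤n = toℚᵘ-cancel-≤ (ℚᵘ.≤-respˡ-≃ (ℚᵘ.≃-sym (⟦⟧ᵘ m)) (ℚᵘ.≤-respʳ-≃ (ℚᵘ.≃-sym (⟦⟧ᵘ n))
    (ℚᵘ.*≤* (subst₂ ℤ._≤_ (sym (ℤ.*-identityʳ (+ m))) (sym (ℤ.*-identityʳ (+ n))) (+≤+ m≤n)))))

  ⟦⟧-mono-< : ∀ {m n} → m ℕ.< n → ⟦ m ⟧ < ⟦ n ⟧
  ⟦⟧-mono-< {m} {n} m<n = toℚᵘ-cancel-< (ℚᵘ.<-respˡ-≃ (ℚᵘ.≃-sym (⟦⟧ᵘ m)) (ℚᵘ.<-respʳ-≃ (ℚᵘ.≃-sym (⟦⟧ᵘ n))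
    (ℚᵘ.*<* (subst₂ ℤ._<_ (sym (ℤ.*-identityʳ (+ m))) (sym (ℤ.*-identityʳ (+ n))) (+<+ m<n)))))

  ⟦⟧≢0 : ∀ n → 0 ℕ.< n → ⟦ n ⟧ ≢ 0ℚ
  ⟦⟧≢0 n 0<n n≡0 = <⇒≢ (⟦⟧-mono-< 0<n) (sym n≡0)

  a/d*d≡a : ∀ a d → ((+ a) / suc d) * ⟦ suc d ⟧ ≡ ⟦ a ⟧
  a/d*d≡a a d = toℚᵘ-injective (begin
    toℚᵘ ((+ a) / suc d * ⟦ suc d ⟧)                     ≈⟨ toℚᵘ-homo-* ((+ a) / suc d) ⟦ suc d ⟧ ⟩
    toℚᵘ ((+ a) / suc d) ℚᵘ.* toℚᵘ ⟦ suc d ⟧             ≈⟨ ℚᵘ.*-cong (toℚᵘ-fromℚᵘ (ℚᵘ.mkℚᵘ (+ a) d)) (⟦⟧ᵘ (suc d)) ⟩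
    ℚᵘ.mkℚᵘ (+ a) d ℚᵘ.* ℚᵘ.mkℚᵘ (+ suc d) 0             ≈⟨ ℚᵘ.*≡* (trans (ℤ.*-identityʳ (+ a ℤ.* + suc d))
                                                            (cong (λ k → + a ℤ.* + k) (sym (ℕ.*-identityʳ (suc d))))) ⟩
    ℚᵘ.mkℚᵘ (+ a) 0                                      ≈⟨ ⟦⟧ᵘ a ⟨
    toℚᵘ ⟦ a ⟧                                           ∎)
    where open ℚᵘ.≃-Reasoning

  ⟦pred⟧ : ∀ n → ⟦ n ⟧ ≡ ⟦ suc n ⟧ - 1ℚ
  ⟦pred⟧ n = sym (trans (cong (_- 1ℚ) (⟦+⟧ 1 n)) (cancel ⟦ n ⟧))
    where
    cancel : ∀ x → 1ℚ + x - 1ℚ ≡ x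
    cancel = solve-∀ ℚ-ring

  *-cancelʳ-≢0 : ∀ {x y} q → q ≢ 0ℚ → x * q ≡ y * q → x ≡ y
  *-cancelʳ-≢0 {x} {y} q q≢0 eq = begin
    x                ≡⟨ *-identityʳ x ⟨
    x * 1ℚ           ≡⟨ cong (x *_) (*-inverseʳ q) ⟨
    x * (q * 1/ q)   ≡⟨ *-assoc x q (1/ q) ⟨
    x * q * 1/ q     ≡⟨ cong (_* 1/ q) eq ⟩
    y * q * 1/ q     ≡⟨ *-assoc y q (1/ q) ⟩
    y * (q * 1/ q)   ≡⟨ cong (y *_) (*-inverseʳ q) ⟩
    y * 1ℚ           ≡⟨ *-identityʳ y ⟩
    y                ∎
    where
    open ≡-Reasoning
    instance _ = ≢-nonZero q≢0

  ÷ₜ-*-cancel : ∀ p {q} → q ≢ 0ℚ → (p ÷ₜ q) * q ≡ p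
  ÷ₜ-*-cancel p {q} q≢0 with q ≟ 0ℚ
  ... | yes q≡0  = contradiction q≡0 q≢0
  ... | no  q≢0′ = begin
    p * 1/ q * q     ≡⟨ *-assoc p (1/ q) q ⟩
    p * (1/ q * q)   ≡⟨ cong (p *_) (*-inverseˡ q) ⟩
    p * 1ℚ           ≡⟨ *-identityʳ p ⟩
    p                ∎
    where
    open ≡-Reasoning
    instance _ = ≢-nonZero q≢0′

  ÷ₜ-unique : ∀ {p q r} → q ≢ 0ℚ → r * q ≡ p → p ÷ₜ q ≡ r
  ÷ₜ-unique {p} {q} q≢0 rq≡p = *-cancelʳ-≢0 q q≢0 (trans (÷ₜ-*-cancel p q≢0) (sym rq≡p))

  ⟦2n+1⟧ : ∀ n → ⟦ 2 ℕ.* n ℕ.+ 1 ⟧ ≡ ⟦ 2 ⟧ * ⟦ n ⟧ + ⟦ 1 ⟧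
  ⟦2n+1⟧ n = trans (⟦+⟧ (2 ℕ.* n) 1) (cong (_+ ⟦ 1 ⟧) (⟦*⟧ 2 n))

  W≢0 : ∀ m → ⟦ W yId (suc m) ⟧ ≢ 0ℚ
  W≢0 m = ⟦⟧≢0 (W yId (suc m)) (subst (λ k → 0 ℕ.< k ℕ.+ sumRange 1 (suc m) (A yId (suc m)))
                                      (sym (trans (A-yId m 0 z≤n) (chains-zero yId m))) ℕ.z<s)

  W-rec-ℚ : ∀ n → 2 ℕ.≤ n → (⟦ n ⟧ + ⟦ 2 ⟧) * ⟦ W yId n ⟧ ≡ ⟦ 2 ⟧ * (⟦ 2 ⟧ * ⟦ n ⟧ + ⟦ 1 ⟧) * ⟦ W yId (n ∸ 1) ⟧
  W-rec-ℚ n 2≤n = begin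
    (⟦ n ⟧ + ⟦ 2 ⟧) * ⟦ W yId n ⟧
      ≡⟨ cong (_* ⟦ W yId n ⟧) (⟦+⟧ n 2) ⟨
    ⟦ n ℕ.+ 2 ⟧ * ⟦ W yId n ⟧
      ≡⟨ ⟦*⟧ (n ℕ.+ 2) (W yId n) ⟨
    ⟦ (n ℕ.+ 2) ℕ.* W yId n ⟧
      ≡⟨ cong ⟦_⟧ (W-rec n 2≤n) ⟩
    ⟦ 2 ℕ.* (2 ℕ.* n ℕ.+ 1) ℕ.* W yId (n ∸ 1) ⟧
      ≡⟨ ⟦*⟧ (2 ℕ.* (2 ℕ.* n ℕ.+ 1)) (W yId (n ∸ 1)) ⟩
    ⟦ 2 ℕ.* (2 ℕ.* n ℕ.+ 1) ⟧ * ⟦ W yId (n ∸ 1) ⟧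
      ≡⟨ cong (_* ⟦ W yId (n ∸ 1) ⟧) (trans (⟦*⟧ 2 (2 ℕ.* n ℕ.+ 1)) (cong (⟦ 2 ⟧ *_) (⟦2n+1⟧ n))) ⟩
    ⟦ 2 ⟧ * (⟦ 2 ⟧ * ⟦ n ⟧ + ⟦ 1 ⟧) * ⟦ W yId (n ∸ 1) ⟧ ∎
    where open ≡-Reasoning

  ∣z∣*n≤1 : ∀ z u d n → 0 ℕ.< d → z * ⟦ d ⟧ ≡ ⟦ u ⟧ → u ℕ.* n ℕ.≤ d → ∣ z ∣ * ⟦ n ⟧ ≤ 1ℚ
  ∣z∣*n≤1 z u d n 0<d zd≡u un≤d = subst (λ a → a * ⟦ n ⟧ ≤ 1ℚ) (sym (0≤p⇒∣p∣≡p 0≤z)) zn≤1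
    where
    instance _ = positive (⟦⟧-mono-< 0<d)
    0≤z : 0ℚ ≤ z
    0≤z = *-cancelʳ-≤-pos ⟦ d ⟧ (subst₂ _≤_ (sym (*-zeroˡ ⟦ d ⟧)) (sym zd≡u) (⟦⟧-mono-≤ {0} {u} z≤n))
    zn≤1 : z * ⟦ n ⟧ ≤ 1ℚ
    zn≤1 = *-cancelʳ-≤-pos ⟦ d ⟧ (begin
      z * ⟦ n ⟧ * ⟦ d ⟧    ≡⟨ swap z ⟦ n ⟧ ⟦ d ⟧ ⟩
      z * ⟦ d ⟧ * ⟦ n ⟧    ≡⟨ cong (_* ⟦ n ⟧) zd≡u ⟩
      ⟦ u ⟧ * ⟦ n ⟧        ≡⟨ ⟦*⟧ u n ⟨
      ⟦ u ℕ.* n ⟧          ≤⟨ ⟦⟧-mono-≤ un≤d ⟩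
      ⟦ d ⟧                ≡⟨ *-identityˡ ⟦ d ⟧ ⟨
      1ℚ * ⟦ d ⟧           ∎)
      where
      open ≤-Reasoning
      swap : ∀ a b c → a * b * c ≡ a * c * b
      swap = solve-∀ ℚ-ring

  positive-as-fraction : ∀ ε → ε > 0ℚ → Σ ℕ λ p → Σ ℕ λ q → ε * ⟦ suc q ⟧ ≡ ⟦ suc p ⟧
  positive-as-fraction ε@(mkℚ +[1+ p ] q _) _ = p , q , trans (cong (_* ⟦ suc q ⟧) (sym (fromℚᵘ-toℚᵘ ε))) (a/d*d≡a (suc p) q)
  positive-as-fraction (mkℚ +0       _ _) ε>0 with () ← positive ε>0
  positive-as-fraction (mkℚ -[1+ _ ] _ _) ε>0 with () ← positive ε>0

  convergesTo-if-within-1/n : ∀ a L N₀ → (∀ t → ∣ a (N₀ ℕ.+ t) - L ∣ * ⟦ N₀ ℕ.+ t ⟧ ≤ 1ℚ) → ConvergesTo a L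
  convergesTo-if-within-1/n a L N₀ within ε ε>0 with positive-as-fraction ε ε>0
  ... | p , q , εq≡p = N₀ ℕ.+ suc (suc q) , eventually
    where
    eventually : ∀ n → N₀ ℕ.+ suc (suc q) ℕ.≤ n → ∣ a n - L ∣ < ε
    eventually n N≤n = *-cancelʳ-<-nonNeg ⟦ n ⟧ {{normalize-nonNeg n 1}} (≤-<-trans within-n 1<εn)
      where
      instance _ = positive ε>0
      within-n : ∣ a n - L ∣ * ⟦ n ⟧ ≤ 1ℚ
      within-n = subst (λ k → ∣ a k - L ∣ * ⟦ k ⟧ ≤ 1ℚ) (ℕ.m+[n∸m]≡n (ℕ.m+n≤o⇒m≤o N₀ N≤n)) (within (n ∸ N₀))
      1<εn : 1ℚ < ε * ⟦ n ⟧
      1<εn = begin-strict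
        1ℚ             ≤⟨ ⟦⟧-mono-≤ {1} {suc p} (s≤s z≤n) ⟩
        ⟦ suc p ⟧      ≡⟨ εq≡p ⟨
        ε * ⟦ suc q ⟧  <⟨ *-monoʳ-<-pos ε (⟦⟧-mono-< (ℕ.m+n≤o⇒n≤o N₀ {suc (suc q)} N≤n)) ⟩
        ε * ⟦ n ⟧      ∎
        where open ≤-Reasoning

  ⟦⟧-quotient : ∀ x a d c → x ℕ.* suc d ≡ a ℕ.* c → ⟦ x ⟧ ≡ ((+ a) / suc d) * ⟦ c ⟧
  ⟦⟧-quotient x a d c eq = *-cancelʳ-≢0 ⟦ suc d ⟧ (⟦⟧≢0 (suc d) ℕ.z<s) (begin
    ⟦ x ⟧ * ⟦ suc d ⟧                            ≡⟨ ⟦*⟧ x (suc d) ⟨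
    ⟦ x ℕ.* suc d ⟧                              ≡⟨ cong ⟦_⟧ eq ⟩
    ⟦ a ℕ.* c ⟧                                  ≡⟨ ⟦*⟧ a c ⟩
    ⟦ a ⟧ * ⟦ c ⟧                                ≡⟨ cong (_* ⟦ c ⟧) (a/d*d≡a a d) ⟨
    (+ a) / suc d * ⟦ suc d ⟧ * ⟦ c ⟧            ≡⟨ swap ((+ a) / suc d) ⟦ suc d ⟧ ⟦ c ⟧ ⟩
    (+ a) / suc d * ⟦ c ⟧ * ⟦ suc d ⟧            ∎)
    where
    open ≡-Reasoning
    swap : ∀ a b c → a * b * c ≡ a * c * b
    swap = solve-∀ ℚ-ring

  ⟦a+b*t⟧ : ∀ a b t → ⟦ a ℕ.+ b ℕ.* t ⟧ ≡ ⟦ a ⟧ + ⟦ b ⟧ * ⟦ t ⟧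
  ⟦a+b*t⟧ a b t = trans (⟦+⟧ a (b ℕ.* t)) (cong (λ v → ⟦ a ⟧ + v) (⟦*⟧ b t))

module Ratios (m : ℕ) where

  open RationalArithmetic
  open Ballot using (W-rec)
  open import Data.Nat as ℕ using (ℕ; _∸_; z≤n; s≤s)
  import Data.Nat.Properties as ℕ
  open import Data.Integer using (+_)
  open import Data.Rational using (ℚ; 0ℚ; 1ℚ; _+_; _*_; _-_; _/_)
  open import Relation.Binary.PropositionalEquality
  open import Tactic.RingSolver using (solve-∀)

  n : ℕ
  n = 3 ℕ.+ m

  y w₀ w₁ w₂ Qᵀ Qᴹ : ℚ
  y  = ⟦ n ⟧
  w₀ = ⟦ W yId n ⟧
  w₁ = ⟦ W yId (n ∸ 1) ⟧
  w₂ = ⟦ W yId (n ∸ 2) ⟧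
  Qᵀ = ⟦ 2 ⟧ * y + ⟦ 1 ⟧
  Qᴹ = ⟦ 4 ⟧ * (⟦ 2 ⟧ * y + ⟦ 1 ⟧) * (⟦ 2 ⟧ * y - ⟦ 1 ⟧)

  pred-y : ⟦ n ∸ 1 ⟧ ≡ y - 1ℚ
  pred-y = ⟦pred⟧ (n ∸ 1)

  rec₀ : (y + ⟦ 2 ⟧) * w₀ ≡ ⟦ 2 ⟧ * (⟦ 2 ⟧ * y + ⟦ 1 ⟧) * w₁
  rec₀ = W-rec-ℚ n (s≤s (s≤s z≤n))

  rec₁ : (y - 1ℚ + ⟦ 2 ⟧) * w₁ ≡ ⟦ 2 ⟧ * (⟦ 2 ⟧ * (y - 1ℚ) + ⟦ 1 ⟧) * w₂
  rec₁ = subst (λ v → (v + ⟦ 2 ⟧) * w₁ ≡ ⟦ 2 ⟧ * (⟦ 2 ⟧ * v + ⟦ 1 ⟧) * w₂) pred-y (W-rec-ℚ (n ∸ 1) (s≤s (s≤s z≤n)))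

  Nᵀ Nᴹ : ℕ
  Nᵀ = 2 ℕ.* n ℕ.+ 1
  Nᴹ = 4 ℕ.* Nᵀ ℕ.* (2 ℕ.* (n ∸ 1) ℕ.+ 1)

  Qᵀ-cast : ⟦ Nᵀ ⟧ ≡ Qᵀ
  Qᵀ-cast = ⟦2n+1⟧ n

  Qᴹ-cast : ⟦ Nᴹ ⟧ ≡ Qᴹ
  Qᴹ-cast = begin
    ⟦ 4 ℕ.* Nᵀ ℕ.* (2 ℕ.* (n ∸ 1) ℕ.+ 1) ⟧                ≡⟨ ⟦*⟧ (4 ℕ.* Nᵀ) (2 ℕ.* (n ∸ 1) ℕ.+ 1) ⟩
    ⟦ 4 ℕ.* Nᵀ ⟧ * ⟦ 2 ℕ.* (n ∸ 1) ℕ.+ 1 ⟧                ≡⟨ cong₂ _*_ (⟦*⟧ 4 Nᵀ) (⟦2n+1⟧ (n ∸ 1)) ⟩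
    ⟦ 4 ⟧ * ⟦ Nᵀ ⟧ * (⟦ 2 ⟧ * ⟦ n ∸ 1 ⟧ + ⟦ 1 ⟧)           ≡⟨ cong₂ (λ a b → ⟦ 4 ⟧ * a * (⟦ 2 ⟧ * b + ⟦ 1 ⟧)) Qᵀ-cast pred-y ⟩
    ⟦ 4 ⟧ * Qᵀ * (⟦ 2 ⟧ * (y - 1ℚ) + ⟦ 1 ⟧)                ≡⟨ lower-odd y ⟩
    Qᴹ                                                    ∎
    where
    open ≡-Reasoning
    lower-odd : ∀ y → ⟦ 4 ⟧ * (⟦ 2 ⟧ * y + ⟦ 1 ⟧) * (⟦ 2 ⟧ * (y - 1ℚ) + ⟦ 1 ⟧)
                      ≡ ⟦ 4 ⟧ * (⟦ 2 ⟧ * y + ⟦ 1 ⟧) * (⟦ 2 ⟧ * y - ⟦ 1 ⟧)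
    lower-odd = solve-∀ ℚ-ring

  w₀≢0 : w₀ ≢ 0ℚ
  w₀≢0 = W≢0 (2 ℕ.+ m)

  Qᵀ≢0 : Qᵀ ≢ 0ℚ
  Qᵀ≢0 = subst (_≢ 0ℚ) Qᵀ-cast (⟦⟧≢0 Nᵀ ℕ.z<s)

  Qᴹ≢0 : Qᴹ ≢ 0ℚ
  Qᴹ≢0 = subst (_≢ 0ℚ) Qᴹ-cast (⟦⟧≢0 Nᴹ ℕ.z<s)

  T-scaled : T yId n * Qᵀ ≡ y + ⟦ 2 ⟧
  T-scaled = *-cancelʳ-≢0 w₀ w₀≢0 (begin
    T yId n * Qᵀ * w₀                                    ≡⟨ swap (T yId n) Qᵀ w₀ ⟩
    T yId n * w₀ * Qᵀ                                    ≡⟨ cong (_* Qᵀ) (÷ₜ-*-cancel _ w₀≢0) ⟩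
    (1ℚ + y - ⟦ n ∸ 1 ⟧) * w₁ * Qᵀ                       ≡⟨ cong (λ v → (1ℚ + y - v) * w₁ * Qᵀ) pred-y ⟩
    (1ℚ + y - (y - 1ℚ)) * w₁ * Qᵀ                        ≡⟨ unit-step y w₁ ⟩
    ⟦ 2 ⟧ * (⟦ 2 ⟧ * y + ⟦ 1 ⟧) * w₁                      ≡⟨ rec₀ ⟨
    (y + ⟦ 2 ⟧) * w₀                                     ∎)
    where
    open ≡-Reasoning
    swap : ∀ a b c → a * b * c ≡ a * c * b
    swap = solve-∀ ℚ-ring
    unit-step : ∀ y w → (1ℚ + y - (y - 1ℚ)) * w * (⟦ 2 ⟧ * y + ⟦ 1 ⟧) ≡ ⟦ 2 ⟧ * (⟦ 2 ⟧ * y + ⟦ 1 ⟧) * w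
    unit-step = solve-∀ ℚ-ring

  Pᴹ Pˢ : ℚ
  Pᴹ = (y + ⟦ 2 ⟧) * (⟦ 5 ⟧ * y - ⟦ 7 ⟧)
  Pˢ = ⟦ 3 ⟧ * (y - ⟦ 3 ⟧) * (y - ⟦ 2 ⟧)

  M-scaled : M yId n * Qᴹ ≡ Pᴹ
  M-scaled = *-cancelʳ-≢0 w₀ w₀≢0 (begin
    M yId n * Qᴹ * w₀                                          ≡⟨ swap (M yId n) Qᴹ w₀ ⟩
    M yId n * w₀ * Qᴹ                                          ≡⟨ cong (_* Qᴹ) (÷ₜ-*-cancel _ w₀≢0) ⟩
    sumRangeℚ 1 (n ∸ 1 ∸ (n ∸ 2) ℕ.+ 1) summand * Qᴹ           ≡⟨ cong (λ L → sumRangeℚ 1 (L ℕ.+ 1) summand * Qᴹ) (ℕ.m+n∸n≡m 1 m) ⟩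
    ((w₁ - ⟦ 1 ⟧ * w₂) + ((w₁ - ⟦ 2 ⟧ * w₂) + 0ℚ)) * Qᴹ        ≡⟨ expand y w₁ w₂ ⟩
    ⟦ 8 ⟧ * Qᵀ * (⟦ 2 ⟧ * y - ⟦ 1 ⟧) * w₁
      - ⟦ 6 ⟧ * Qᵀ * (⟦ 2 ⟧ * (⟦ 2 ⟧ * (y - 1ℚ) + ⟦ 1 ⟧) * w₂)  ≡⟨ cong (λ v → ⟦ 8 ⟧ * Qᵀ * (⟦ 2 ⟧ * y - ⟦ 1 ⟧) * w₁ - ⟦ 6 ⟧ * Qᵀ * v) rec₁ ⟨
    ⟦ 8 ⟧ * Qᵀ * (⟦ 2 ⟧ * y - ⟦ 1 ⟧) * w₁
      - ⟦ 6 ⟧ * Qᵀ * ((y - 1ℚ + ⟦ 2 ⟧) * w₁)                    ≡⟨ collect y w₁ ⟩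
    (⟦ 5 ⟧ * y - ⟦ 7 ⟧) * (⟦ 2 ⟧ * Qᵀ * w₁)                     ≡⟨ cong ((⟦ 5 ⟧ * y - ⟦ 7 ⟧) *_) rec₀ ⟨
    (⟦ 5 ⟧ * y - ⟦ 7 ⟧) * ((y + ⟦ 2 ⟧) * w₀)                    ≡⟨ reorder (⟦ 5 ⟧ * y - ⟦ 7 ⟧) (y + ⟦ 2 ⟧) w₀ ⟩
    Pᴹ * w₀                                                    ∎)
    where
    open ≡-Reasoning
    summand = λ k → w₁ - ⟦ k ⟧ * w₂
    swap : ∀ a b c → a * b * c ≡ a * c * b
    swap = solve-∀ ℚ-ring
    expand : ∀ y w₁ w₂ → ((w₁ - ⟦ 1 ⟧ * w₂) + ((w₁ - ⟦ 2 ⟧ * w₂) + 0ℚ)) * (⟦ 4 ⟧ * (⟦ 2 ⟧ * y + ⟦ 1 ⟧) * (⟦ 2 ⟧ * y - ⟦ 1 ⟧))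
                         ≡ ⟦ 8 ⟧ * (⟦ 2 ⟧ * y + ⟦ 1 ⟧) * (⟦ 2 ⟧ * y - ⟦ 1 ⟧) * w₁
                           - ⟦ 6 ⟧ * (⟦ 2 ⟧ * y + ⟦ 1 ⟧) * (⟦ 2 ⟧ * (⟦ 2 ⟧ * (y - 1ℚ) + ⟦ 1 ⟧) * w₂)
    expand = solve-∀ ℚ-ring
    collect : ∀ y w → ⟦ 8 ⟧ * (⟦ 2 ⟧ * y + ⟦ 1 ⟧) * (⟦ 2 ⟧ * y - ⟦ 1 ⟧) * w - ⟦ 6 ⟧ * (⟦ 2 ⟧ * y + ⟦ 1 ⟧) * ((y - 1ℚ + ⟦ 2 ⟧) * w)
                      ≡ (⟦ 5 ⟧ * y - ⟦ 7 ⟧) * (⟦ 2 ⟧ * (⟦ 2 ⟧ * y + ⟦ 1 ⟧) * w)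
    collect = solve-∀ ℚ-ring
    reorder : ∀ a b c → a * (b * c) ≡ b * a * c
    reorder = solve-∀ ℚ-ring

  S-scaled : S yId n * Qᴹ ≡ Pˢ
  S-scaled = begin
    (1ℚ - M yId n - T yId n) * Qᴹ                              ≡⟨ distribute y (M yId n) (T yId n) ⟩
    Qᴹ - M yId n * Qᴹ - ⟦ 4 ⟧ * (⟦ 2 ⟧ * y - ⟦ 1 ⟧) * (T yId n * Qᵀ) ≡⟨ cong₂ (λ a b → Qᴹ - a - ⟦ 4 ⟧ * (⟦ 2 ⟧ * y - ⟦ 1 ⟧) * b) M-scaled T-scaled ⟩
    Qᴹ - Pᴹ - ⟦ 4 ⟧ * (⟦ 2 ⟧ * y - ⟦ 1 ⟧) * (y + ⟦ 2 ⟧)          ≡⟨ simplify y ⟩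
    Pˢ                                                         ∎
    where
    open ≡-Reasoning
    distribute : ∀ y a b → (1ℚ - a - b) * (⟦ 4 ⟧ * (⟦ 2 ⟧ * y + ⟦ 1 ⟧) * (⟦ 2 ⟧ * y - ⟦ 1 ⟧))
                           ≡ ⟦ 4 ⟧ * (⟦ 2 ⟧ * y + ⟦ 1 ⟧) * (⟦ 2 ⟧ * y - ⟦ 1 ⟧)
                             - a * (⟦ 4 ⟧ * (⟦ 2 ⟧ * y + ⟦ 1 ⟧) * (⟦ 2 ⟧ * y - ⟦ 1 ⟧))
                             - ⟦ 4 ⟧ * (⟦ 2 ⟧ * y - ⟦ 1 ⟧) * (b * (⟦ 2 ⟧ * y + ⟦ 1 ⟧))
    distribute = solve-∀ ℚ-ring
    simplify : ∀ y → ⟦ 4 ⟧ * (⟦ 2 ⟧ * y + ⟦ 1 ⟧) * (⟦ 2 ⟧ * y - ⟦ 1 ⟧) - (y + ⟦ 2 ⟧) * (⟦ 5 ⟧ * y - ⟦ 7 ⟧)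
                     - ⟦ 4 ⟧ * (⟦ 2 ⟧ * y - ⟦ 1 ⟧) * (y + ⟦ 2 ⟧)
                     ≡ ⟦ 3 ⟧ * (y - ⟦ 3 ⟧) * (y - ⟦ 2 ⟧)
    simplify = solve-∀ ℚ-ring

  T-formula : T yId n ≡ (y + ⟦ 2 ⟧) ÷ₜ Qᵀ
  T-formula = sym (÷ₜ-unique Qᵀ≢0 T-scaled)

  M-formula : M yId n ≡ Pᴹ ÷ₜ Qᴹ
  M-formula = sym (÷ₜ-unique Qᴹ≢0 M-scaled)

  S-formula : S yId n ≡ Pˢ ÷ₜ Qᴹ
  S-formula = sym (÷ₜ-unique Qᴹ≢0 S-scaled)

  T-error : (T yId n - (+ 1) / 2) * (⟦ 2 ⟧ * Qᵀ) ≡ ⟦ 3 ⟧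
  T-error = begin
    (T yId n - (+ 1) / 2) * (⟦ 2 ⟧ * Qᵀ)   ≡⟨ expand (T yId n) y ⟩
    ⟦ 2 ⟧ * (T yId n * Qᵀ) - Qᵀ           ≡⟨ cong (λ a → ⟦ 2 ⟧ * a - Qᵀ) T-scaled ⟩
    ⟦ 2 ⟧ * (y + ⟦ 2 ⟧) - Qᵀ              ≡⟨ simplify y ⟩
    ⟦ 3 ⟧                                 ∎
    where
    open ≡-Reasoning
    expand : ∀ a y → (a - (+ 1) / 2) * (⟦ 2 ⟧ * (⟦ 2 ⟧ * y + ⟦ 1 ⟧)) ≡ ⟦ 2 ⟧ * (a * (⟦ 2 ⟧ * y + ⟦ 1 ⟧)) - (⟦ 2 ⟧ * y + ⟦ 1 ⟧)
    expand = solve-∀ ℚ-ring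
    simplify : ∀ y → ⟦ 2 ⟧ * (y + ⟦ 2 ⟧) - (⟦ 2 ⟧ * y + ⟦ 1 ⟧) ≡ ⟦ 3 ⟧
    simplify = solve-∀ ℚ-ring

  M-error : (M yId n - (+ 5) / 16) * (⟦ 4 ⟧ * Qᴹ) ≡ ⟦ 12 ⟧ * y - ⟦ 51 ⟧
  M-error = begin
    (M yId n - (+ 5) / 16) * (⟦ 4 ⟧ * Qᴹ)                          ≡⟨ expand (M yId n) y ⟩
    ⟦ 4 ⟧ * (M yId n * Qᴹ) - ⟦ 5 ⟧ * (Qᵀ * (⟦ 2 ⟧ * y - ⟦ 1 ⟧))    ≡⟨ cong (λ a → ⟦ 4 ⟧ * a - ⟦ 5 ⟧ * (Qᵀ * (⟦ 2 ⟧ * y - ⟦ 1 ⟧))) M-scaled ⟩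
    ⟦ 4 ⟧ * Pᴹ - ⟦ 5 ⟧ * (Qᵀ * (⟦ 2 ⟧ * y - ⟦ 1 ⟧))                ≡⟨ simplify y ⟩
    ⟦ 12 ⟧ * y - ⟦ 51 ⟧                                           ∎
    where
    open ≡-Reasoning
    expand : ∀ a y → (a - (+ 5) / 16) * (⟦ 4 ⟧ * (⟦ 4 ⟧ * (⟦ 2 ⟧ * y + ⟦ 1 ⟧) * (⟦ 2 ⟧ * y - ⟦ 1 ⟧)))
                     ≡ ⟦ 4 ⟧ * (a * (⟦ 4 ⟧ * (⟦ 2 ⟧ * y + ⟦ 1 ⟧) * (⟦ 2 ⟧ * y - ⟦ 1 ⟧)))
                       - ⟦ 5 ⟧ * ((⟦ 2 ⟧ * y + ⟦ 1 ⟧) * (⟦ 2 ⟧ * y - ⟦ 1 ⟧))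
    expand = solve-∀ ℚ-ring
    simplify : ∀ y → ⟦ 4 ⟧ * ((y + ⟦ 2 ⟧) * (⟦ 5 ⟧ * y - ⟦ 7 ⟧)) - ⟦ 5 ⟧ * ((⟦ 2 ⟧ * y + ⟦ 1 ⟧) * (⟦ 2 ⟧ * y - ⟦ 1 ⟧))
                     ≡ ⟦ 12 ⟧ * y - ⟦ 51 ⟧
    simplify = solve-∀ ℚ-ring

  S-error : ((+ 3) / 16 - S yId n) * (⟦ 4 ⟧ * Qᴹ) ≡ ⟦ 60 ⟧ * y - ⟦ 75 ⟧
  S-error = begin
    ((+ 3) / 16 - S yId n) * (⟦ 4 ⟧ * Qᴹ)                          ≡⟨ expand (S yId n) y ⟩
    ⟦ 3 ⟧ * (Qᵀ * (⟦ 2 ⟧ * y - ⟦ 1 ⟧)) - ⟦ 4 ⟧ * (S yId n * Qᴹ)    ≡⟨ cong (λ a → ⟦ 3 ⟧ * (Qᵀ * (⟦ 2 ⟧ * y - ⟦ 1 ⟧)) - ⟦ 4 ⟧ * a) S-scaled ⟩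
    ⟦ 3 ⟧ * (Qᵀ * (⟦ 2 ⟧ * y - ⟦ 1 ⟧)) - ⟦ 4 ⟧ * Pˢ                ≡⟨ simplify y ⟩
    ⟦ 60 ⟧ * y - ⟦ 75 ⟧                                           ∎
    where
    open ≡-Reasoning
    expand : ∀ a y → ((+ 3) / 16 - a) * (⟦ 4 ⟧ * (⟦ 4 ⟧ * (⟦ 2 ⟧ * y + ⟦ 1 ⟧) * (⟦ 2 ⟧ * y - ⟦ 1 ⟧)))
                     ≡ ⟦ 3 ⟧ * ((⟦ 2 ⟧ * y + ⟦ 1 ⟧) * (⟦ 2 ⟧ * y - ⟦ 1 ⟧))
                       - ⟦ 4 ⟧ * (a * (⟦ 4 ⟧ * (⟦ 2 ⟧ * y + ⟦ 1 ⟧) * (⟦ 2 ⟧ * y - ⟦ 1 ⟧)))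
    expand = solve-∀ ℚ-ring
    simplify : ∀ y → ⟦ 3 ⟧ * ((⟦ 2 ⟧ * y + ⟦ 1 ⟧) * (⟦ 2 ⟧ * y - ⟦ 1 ⟧)) - ⟦ 4 ⟧ * (⟦ 3 ⟧ * (y - ⟦ 3 ⟧) * (y - ⟦ 2 ⟧))
                     ≡ ⟦ 60 ⟧ * y - ⟦ 75 ⟧
    simplify = solve-∀ ℚ-ring

module Limits where

  open RationalArithmetic
  open import Data.Nat as ℕ using (ℕ)
  import Data.Nat.Properties as ℕ
  open import Data.Nat.Tactic.RingSolver as ℕ-Solver using ()
  open import Data.Integer using (+_)
  open import Data.Rational using (ℚ; 1ℚ; _+_; _*_; _-_; -_; _/_; ∣_∣; _≤_)
  open import Data.Rational.Properties using (∣-p∣≡∣p∣)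
  open import Relation.Binary.PropositionalEquality
  open import Tactic.RingSolver using (solve-∀)

  -- The bounds start at n = 5 because M(n) - 5/16 = (12n - 51) / (16 (4n² - 1)) is negative for n ≤ 4.

  T-within-1/n : ∀ t → ∣ T yId (5 ℕ.+ t) - (+ 1) / 2 ∣ * ⟦ 5 ℕ.+ t ⟧ ≤ 1ℚ
  T-within-1/n t = ∣z∣*n≤1 (T yId n - (+ 1) / 2) 3 (2 ℕ.* Nᵀ) n ℕ.z<s scaled
                     (subst (3 ℕ.* n ℕ.≤_) (sym (slack n)) (ℕ.m≤m+n (3 ℕ.* n) (n ℕ.+ 2)))
    where
    open Ratios (2 ℕ.+ t)
    scaled : (T yId n - (+ 1) / 2) * ⟦ 2 ℕ.* Nᵀ ⟧ ≡ ⟦ 3 ⟧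
    scaled = trans (cong ((T yId n - (+ 1) / 2) *_) (trans (⟦*⟧ 2 Nᵀ) (cong (⟦ 2 ⟧ *_) Qᵀ-cast))) T-error
    slack : ∀ n → 2 ℕ.* (2 ℕ.* n ℕ.+ 1) ≡ 3 ℕ.* n ℕ.+ (n ℕ.+ 2)
    slack = ℕ-Solver.solve-∀

  M-within-1/n : ∀ t → ∣ M yId (5 ℕ.+ t) - (+ 5) / 16 ∣ * ⟦ 5 ℕ.+ t ⟧ ≤ 1ℚ
  M-within-1/n t = ∣z∣*n≤1 (M yId n - (+ 5) / 16) u (4 ℕ.* Nᴹ) n ℕ.z<s scaled
                     (subst (u ℕ.* n ℕ.≤_) (sym (slack t)) (ℕ.m≤m+n (u ℕ.* n) _))
    where
    open Ratios (2 ℕ.+ t)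
    u = 9 ℕ.+ 12 ℕ.* t
    scaled : (M yId n - (+ 5) / 16) * ⟦ 4 ℕ.* Nᴹ ⟧ ≡ ⟦ u ⟧
    scaled = begin
      (M yId n - (+ 5) / 16) * ⟦ 4 ℕ.* Nᴹ ⟧     ≡⟨ cong ((M yId n - (+ 5) / 16) *_) (trans (⟦*⟧ 4 Nᴹ) (cong (⟦ 4 ⟧ *_) Qᴹ-cast)) ⟩
      (M yId n - (+ 5) / 16) * (⟦ 4 ⟧ * Qᴹ)     ≡⟨ M-error ⟩
      ⟦ 12 ⟧ * y - ⟦ 51 ⟧                       ≡⟨ cong (λ v → ⟦ 12 ⟧ * v - ⟦ 51 ⟧) (⟦+⟧ 5 t) ⟩
      ⟦ 12 ⟧ * (⟦ 5 ⟧ + ⟦ t ⟧) - ⟦ 51 ⟧          ≡⟨ shift ⟦ t ⟧ ⟩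
      ⟦ 9 ⟧ + ⟦ 12 ⟧ * ⟦ t ⟧                     ≡⟨ ⟦a+b*t⟧ 9 12 t ⟨
      ⟦ u ⟧                                     ∎
      where
      open ≡-Reasoning
      shift : ∀ x → ⟦ 12 ⟧ * (⟦ 5 ⟧ + x) - ⟦ 51 ⟧ ≡ ⟦ 9 ⟧ + ⟦ 12 ⟧ * x
      shift = solve-∀ ℚ-ring
    slack : ∀ t → 4 ℕ.* (4 ℕ.* (2 ℕ.* (5 ℕ.+ t) ℕ.+ 1) ℕ.* (2 ℕ.* (4 ℕ.+ t) ℕ.+ 1))
                  ≡ (9 ℕ.+ 12 ℕ.* t) ℕ.* (5 ℕ.+ t) ℕ.+ (1539 ℕ.+ 571 ℕ.* t ℕ.+ 52 ℕ.* (t ℕ.* t))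
    slack = ℕ-Solver.solve-∀

  S-within-1/n : ∀ t → ∣ S yId (5 ℕ.+ t) - (+ 3) / 16 ∣ * ⟦ 5 ℕ.+ t ⟧ ≤ 1ℚ
  S-within-1/n t = subst (λ e → e * ⟦ n ⟧ ≤ 1ℚ) (trans (cong ∣_∣ (flip (S yId n) ((+ 3) / 16))) (∣-p∣≡∣p∣ _))
                     (∣z∣*n≤1 ((+ 3) / 16 - S yId n) u (4 ℕ.* Nᴹ) n ℕ.z<s scaled
                       (subst (u ℕ.* n ℕ.≤_) (sym (slack t)) (ℕ.m≤m+n (u ℕ.* n) _)))
    where
    open Ratios (2 ℕ.+ t)
    u = 225 ℕ.+ 60 ℕ.* t
    flip : ∀ a b → b - a ≡ - (a - b)
    flip = solve-∀ ℚ-ring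
    scaled : ((+ 3) / 16 - S yId n) * ⟦ 4 ℕ.* Nᴹ ⟧ ≡ ⟦ u ⟧
    scaled = begin
      ((+ 3) / 16 - S yId n) * ⟦ 4 ℕ.* Nᴹ ⟧     ≡⟨ cong (((+ 3) / 16 - S yId n) *_) (trans (⟦*⟧ 4 Nᴹ) (cong (⟦ 4 ⟧ *_) Qᴹ-cast)) ⟩
      ((+ 3) / 16 - S yId n) * (⟦ 4 ⟧ * Qᴹ)     ≡⟨ S-error ⟩
      ⟦ 60 ⟧ * y - ⟦ 75 ⟧                       ≡⟨ cong (λ v → ⟦ 60 ⟧ * v - ⟦ 75 ⟧) (⟦+⟧ 5 t) ⟩
      ⟦ 60 ⟧ * (⟦ 5 ⟧ + ⟦ t ⟧) - ⟦ 75 ⟧          ≡⟨ shift ⟦ t ⟧ ⟩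
      ⟦ 225 ⟧ + ⟦ 60 ⟧ * ⟦ t ⟧                   ≡⟨ ⟦a+b*t⟧ 225 60 t ⟨
      ⟦ u ⟧                                     ∎
      where
      open ≡-Reasoning
      shift : ∀ x → ⟦ 60 ⟧ * (⟦ 5 ⟧ + x) - ⟦ 75 ⟧ ≡ ⟦ 225 ⟧ + ⟦ 60 ⟧ * x
      shift = solve-∀ ℚ-ring
    slack : ∀ t → 4 ℕ.* (4 ℕ.* (2 ℕ.* (5 ℕ.+ t) ℕ.+ 1) ℕ.* (2 ℕ.* (4 ℕ.+ t) ℕ.+ 1))
                  ≡ (225 ℕ.+ 60 ℕ.* t) ℕ.* (5 ℕ.+ t) ℕ.+ (459 ℕ.+ 115 ℕ.* t ℕ.+ 4 ℕ.* (t ℕ.* t))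
    slack = ℕ-Solver.solve-∀

open import Data.Nat using (ℕ; suc; _≤_; _<_; _∸_; z≤n; s≤s)
open import Data.Nat as ℕ using ()
import Data.Nat.Properties as ℕ
open import Data.Nat.Combinatorics using (_C_)
open import Data.Integer using (+_)
open import Data.Rational using (ℚ; _/_; _*_; _+_; _-_)
open import Data.Product using (_×_; _,_)
open import Relation.Binary.PropositionalEquality using (_≡_; cong₂; subst; sym; trans)
open Ballot using (A-closed; A-yId-beyond; W-catalan)
open RationalArithmetic using (⟦⟧-quotient; convergesTo-if-within-1/n)
open Limits

from-offset : ∀ {P : ℕ → Set} k → (∀ m → P (k ℕ.+ m)) → ∀ n → k ≤ n → P n
from-offset {P} k P[k+_] n k≤n = subst P (ℕ.m+[n∸m]≡n k≤n) P[k+ n ∸ k ]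

theorem6p4 : ((n k : ℕ) → 1 ≤ n → k ≤ n →
                ⟦ A yId n k ⟧ ≡ ((+ (n ∸ k ℕ.+ 1)) / suc n) * ⟦ (n ℕ.+ k) C k ⟧)
           × ((n k : ℕ) → 1 ≤ n → n < k → A yId n k ≡ 0)
           × ((n : ℕ) → 3 ≤ n →
                (⟦ W yId n ⟧ ≡ catalan (n ℕ.+ 1))
              × (catalan (n ℕ.+ 1) ≡ ((+ 1) / suc (suc n)) * ⟦ (2 ℕ.* n ℕ.+ 2) C (n ℕ.+ 1) ⟧)
              × (T yId n ≡ (⟦ n ⟧ + ⟦ 2 ⟧) ÷ₜ (⟦ 2 ⟧ * ⟦ n ⟧ + ⟦ 1 ⟧))
              × (M yId n ≡ ((⟦ n ⟧ + ⟦ 2 ⟧) * (⟦ 5 ⟧ * ⟦ n ⟧ - ⟦ 7 ⟧))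
                           ÷ₜ (⟦ 4 ⟧ * (⟦ 2 ⟧ * ⟦ n ⟧ + ⟦ 1 ⟧) * (⟦ 2 ⟧ * ⟦ n ⟧ - ⟦ 1 ⟧)))
              × (S yId n ≡ (⟦ 3 ⟧ * (⟦ n ⟧ - ⟦ 3 ⟧) * (⟦ n ⟧ - ⟦ 2 ⟧))
                           ÷ₜ (⟦ 4 ⟧ * (⟦ 2 ⟧ * ⟦ n ⟧ + ⟦ 1 ⟧) * (⟦ 2 ⟧ * ⟦ n ⟧ - ⟦ 1 ⟧))))
           × ConvergesTo (T yId) ((+ 1) / 2)
           × ConvergesTo (M yId) ((+ 5) / 16)
           × ConvergesTo (S yId) ((+ 3) / 16)
theorem6p4 =
    (λ n k 1≤n k≤n → ⟦⟧-quotient (A yId n k) (n ∸ k ℕ.+ 1) n ((n ℕ.+ k) C k) (A-closed n k 1≤n k≤n))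
  , (λ { (suc m) k _ n<k → A-yId-beyond m k n<k })
  , from-offset 3 (λ m → let open Ratios m in
        ⟦⟧-quotient (W yId n) 1 (n ℕ.+ 1) _ (trans (W-catalan n (s≤s z≤n)) (sym (ℕ.*-identityˡ _)))
      , cong₂ (λ d c → ((+ 1) / suc d) * ⟦ c C (n ℕ.+ 1) ⟧) (ℕ.+-comm n 1) (ℕ.*-distribˡ-+ 2 n 1)
      , T-formula , M-formula , S-formula)
  , convergesTo-if-within-1/n (T yId) ((+ 1) / 2) 5 T-within-1/n
  , convergesTo-if-within-1/n (M yId) ((+ 5) / 16) 5 M-within-1/n
  , convergesTo-if-within-1/n (S yId) ((+ 3) / 16) 5 S-within-1/n
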